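{- Let $1\leq i\leq d$ be integers. Then, as an identity of rational functions in $q$, \[ \sum_{\mu\subseteq\{1,\dots,i-1\}} \binom{d}{\mu\cup\{i\}}_q\ \prod_{j\in \mu} q^{j^2}\prod_{j\in\{1,\dots,i-1\}\setminus \mu}(1- q^{j^2}) = \binom{d}{i}_q\ \prod_{j=1}^{i}\frac{1-q^{j^2}}{1-q^j}. \]
   Context: $[n]_q=1+q+\dots+q^{n-1}$, $[n]_q!=[n]_q[n-1]_q\cdots[1]_q$ ($[0]_q!=1$), $\binom{n}{j}_q=\frac{[n]_q!}{[j]_q![n-j]_q!}$, and for $m_0+\dots+m_k=n$, $\binom{n}{m_0,\dots,m_k}_q=\frac{[n]_q!}{[m_0]_q!\cdots[m_k]_q!}$. For a subset $\lambda\subseteq\{1,\dots,d\}$: if $\lambda=\emptyset$ set $\binom{d}{\lambda}_q=1$; otherwise write $\lambda=\{\lambda_1,\dots,\lambda_k\}$ with $d\ge\lambda_1>\dots>\lambda_k\ge1$, put $\lambda_0=d$, $\lambda_{k+1}=0$, $m_i=\lambda_i-\lambda_{i+1}$ for $0\le i\le k$, and define $\binom{d}{\lambda}_q=\binom{d}{m_0,m_1,\dots,m_k}_q$. -}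

module Defs where

open import Data.Nat using (ℕ; zero; suc; _∸_; _≡ᵇ_; _<ᵇ_)
import Data.Nat as ℕ
open import Data.Bool using (Bool; true; false; if_then_else_; _∨_; _∧_)
open import Data.List using (List; []; _∷_; concatMap; foldr; map)
open import Data.Rational using (ℚ; 0ℚ; 1ℚ; _+_; _*_; _-_; _÷_; ≢-nonZero)
open import Data.Rational.Properties using (_≟_)
open import Relation.Nullary using (yes; no)

_^_ : ℚ → ℕ → ℚ
q ^ zero = 1ℚ
q ^ suc n = q * (q ^ n)

-- total division on ℚ (x / 0 := 0); only used where the divisor is nonzero
_÷'_ : ℚ → ℚ → ℚ
p ÷' r with r ≟ 0ℚ
... | yes _ = 0ℚ
... | no ne = _÷_ p r {{≢-nonZero ne}}

qint : ℚ → ℕ → ℚ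
qint q zero = 0ℚ
qint q (suc n) = (q ^ n) + qint q n

qfact : ℚ → ℕ → ℚ
qfact q zero = 1ℚ
qfact q (suc n) = qint q (suc n) * qfact q n

qbinom : ℚ → ℕ → ℕ → ℚ
qbinom q n j = qfact q n ÷' (qfact q j * qfact q (n ∸ j))

prodℚ : List ℚ → ℚ
prodℚ = foldr _*_ 1ℚ

sumℚ : List ℚ → ℚ
sumℚ = foldr _+_ 0ℚ

qmultinom : ℚ → ℕ → List ℕ → ℚ
qmultinom q n ms = qfact q n ÷' prodℚ (map (qfact q) ms)

-- subsets of {1,...,n} represented by characteristic functions ℕ → Bool
-- (only the values on 1..n matter)
Subset : Set
Subset = ℕ → Bool

allSubsets : ℕ → List Subset
allSubsets zero = (λ _ → false) ∷ []
allSubsets (suc n) =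
  concatMap (λ P → P ∷ (λ j → (j ≡ᵇ suc n) ∨ P j) ∷ []) (allSubsets n)

elemsDesc : Subset → ℕ → List ℕ
elemsDesc P zero = []
elemsDesc P (suc n) = if P (suc n) then suc n ∷ elemsDesc P n else elemsDesc P n

-- given λ_0 = prev and λ_1 > ... > λ_k, the parts m_i = λ_i - λ_{i+1}
-- (with λ_{k+1} = 0)
parts : ℕ → List ℕ → List ℕ
parts prev [] = prev ∷ []
parts prev (x ∷ xs) = (prev ∸ x) ∷ parts x xs

qbinomSet : ℚ → ℕ → Subset → ℚ
qbinomSet q d P with elemsDesc P d
... | [] = 1ℚ
... | l@(_ ∷ _) = qmultinom q d (parts d l)

insertSub : Subset → ℕ → Subset
insertSub P i j = (j ≡ᵇ i) ∨ P j

range1 : ℕ → List ℕ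
range1 zero = []
range1 (suc n) = suc n ∷ range1 n

weight : ℚ → ℕ → Subset → ℚ
weight q n P = prodℚ (map (λ j → if P j then q ^ (j ℕ.* j) else 1ℚ - q ^ (j ℕ.* j)) (range1 n))

lhs : ℚ → ℕ → ℕ → ℚ
lhs q d i = sumℚ (map (λ μ → qbinomSet q d (insertSub μ i) * weight q (i ∸ 1) μ) (allSubsets (i ∸ 1)))

rhs : ℚ → ℕ → ℕ → ℚ
rhs q d i = qbinom q d i * prodℚ (map (λ j → (1ℚ - q ^ (j ℕ.* j)) ÷' (1ℚ - q ^ j)) (range1 i))

-- Since binom{d}{μ ∪ {i}}_q = [d i]_q binom{i}{μ}_q, the left side is [d i]_q times
-- W(i, i-1), where W(a, n) = ∑_{μ ⊆ {1,…,n}} binom{a}{μ}_q ∏_{j∈μ} q^(j²) ∏_{j∉μ} (1 - q^(j²)).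
-- Splitting on whether n ∈ μ and peeling off binom{a}{n}_q, induction on n gives, for n ≤ a,
--   (q;q)_a W(a, n) = ∏_{j≤n} (1 - q^(j²)) ∑_{b≤n} [a b]_q q^(b²) (q^(b+1);q)_(a-b),
-- where the step uses the Durfee-square identity ∑_{b≤a} [a b]_q q^(b(k+b)) (q^(k+b+1);q)_(a-b) = 1
-- (induction on a via the q-Pascal rule). For a = i and n = i - 1 the partial Durfee sum is
-- 1 - q^(i²), so W(i, i-1) = ∏_{j≤i} (1 - q^(j²)) / (q;q)_i. The hypothesis q ≠ ±1 only makes
-- the q-factorials and the factors 1 - q^j nonzero.

module Submission where

open import Defs
open import Algebra.Bundles using (CommutativeRing)
open import Data.Bool using (true; false)
open import Data.Bool.Properties using (¬-not; T-≡)
open import Data.Empty using (⊥-elim)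
open import Data.Fin using (toℕ)
open import Data.Fin.Properties using (toℕ-fromℕ; toℕ-inject₁; toℕ≤pred[n])
open import Data.List using (List; []; _∷_; concatMap; map)
open import Data.List.Properties using (map-cong-local)
open import Data.List.Relation.Unary.All using (All; []; _∷_)
import Data.List.Relation.Unary.All as All
open import Data.Nat using (ℕ; zero; suc; _∸_; _≡ᵇ_; _≤_; _<_; _≤′_; ≤′-refl; ≤′-step; s≤s)
import Data.Nat as ℕ
import Data.Nat.Properties as ℕ
import Data.Rational as ℚ using (_<_; _≤_)
open import Data.Rational using (ℚ; 0ℚ; 1ℚ; _+_; _*_; _-_; -_; 1/_; NonZero; NonNegative;
  ≢-nonZero; nonNegative; nonPositive)
import Data.Rational.Properties as ℚ
open import Data.Rational.Solver using (module +-*-Solver)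
open +-*-Solver using (solve; _:=_; _:+_; _:*_; _:-_; con)
open import Data.Sum using (inj₁; inj₂)
open import Function using (_∘_; Equivalence)
open import Relation.Binary.Definitions using (tri<; tri≈; tri>)
open import Relation.Binary.PropositionalEquality
open import Relation.Nullary using (yes; no)
open import Algebra.Properties.Group ℚ.+-0-group using (x∙y⁻¹≈ε⇒x≈y; x≈y⇒x∙y⁻¹≈ε)
open import Algebra.Properties.Semiring.Sum (CommutativeRing.semiring ℚ.+-*-commutativeRing)
  using (sum⁺-syntax; sum-cong-≗; sum-init-last; ∑-distrib-+)

open ≡-Reasoning

÷'-≡-*1/ : ∀ x {y} (y≢0 : y ≢ 0ℚ) → x ÷' y ≡ x * 1/_ y {{≢-nonZero y≢0}}
÷'-≡-*1/ x {y} y≢0 with y ℚ.≟ 0ℚ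
... | yes y≡0 = ⊥-elim (y≢0 y≡0)
... | no _ = refl

÷'-unique : ∀ {x y z} → y ≢ 0ℚ → y * z ≡ x → x ÷' y ≡ z
÷'-unique {y = y} {z} y≢0 refl = begin
  (y * z) ÷' y    ≡⟨ ÷'-≡-*1/ (y * z) y≢0 ⟩
  y * z * 1/ y    ≡⟨ solve 3 (λ y z y⁻¹ → y :* z :* y⁻¹ := z :* (y :* y⁻¹)) refl y z (1/ y) ⟩
  z * (y * 1/ y)  ≡⟨ cong (z *_) (ℚ.*-inverseʳ y) ⟩
  z * 1ℚ          ≡⟨ ℚ.*-identityʳ z ⟩
  z               ∎
  where instance _ : NonZero y
                 _ = ≢-nonZero y≢0

*-÷'-cancel : ∀ x {y} → y ≢ 0ℚ → y * (x ÷' y) ≡ x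
*-÷'-cancel x {y} y≢0 = begin
  y * (x ÷' y)    ≡⟨ cong (y *_) (÷'-≡-*1/ x y≢0) ⟩
  y * (x * 1/ y)  ≡⟨ solve 3 (λ y x y⁻¹ → y :* (x :* y⁻¹) := x :* (y :* y⁻¹)) refl y x (1/ y) ⟩
  x * (y * 1/ y)  ≡⟨ cong (x *_) (ℚ.*-inverseʳ y) ⟩
  x * 1ℚ          ≡⟨ ℚ.*-identityʳ x ⟩
  x               ∎
  where instance _ : NonZero y
                 _ = ≢-nonZero y≢0

*-≢0 : ∀ {x y} → x ≢ 0ℚ → y ≢ 0ℚ → x * y ≢ 0ℚ
*-≢0 {x} {y} x≢0 y≢0 xy≡0 = y≢0 (begin
  y             ≡⟨ ÷'-unique x≢0 refl ⟨
  (x * y) ÷' x  ≡⟨ cong (_÷' x) xy≡0 ⟩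
  0ℚ ÷' x       ≡⟨ ÷'-unique x≢0 (ℚ.*-zeroʳ x) ⟩
  0ℚ            ∎)

x≢y⇒x-y≢0 : ∀ {x y} → x ≢ y → x - y ≢ 0ℚ
x≢y⇒x-y≢0 {x} {y} x≢y = x≢y ∘ x∙y⁻¹≈ε⇒x≈y x y

^-distribˡ-+-* : ∀ q m n → q ^ (m ℕ.+ n) ≡ q ^ m * q ^ n
^-distribˡ-+-* q zero    n = sym (ℚ.*-identityˡ _)
^-distribˡ-+-* q (suc m) n = trans (cong (q *_) (^-distribˡ-+-* q m n)) (sym (ℚ.*-assoc q _ _))

^-distribʳ-* : ∀ x y n → (x * y) ^ n ≡ x ^ n * y ^ n
^-distribʳ-* x y zero    = refl
^-distribʳ-* x y (suc n) = trans (cong ((x * y) *_) (^-distribʳ-* x y n))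
  (solve 4 (λ x y xⁿ yⁿ → x :* y :* (xⁿ :* yⁿ) := x :* xⁿ :* (y :* yⁿ)) refl x y (x ^ n) (y ^ n))

module _ (r : ℚ) .{{_ : NonNegative r}} where

  ^-suc≤ : r ℚ.< 1ℚ → ∀ n → r ^ suc n ℚ.≤ r
  ^-suc≤ r<1 zero    = ℚ.≤-reflexive (ℚ.*-identityʳ r)
  ^-suc≤ r<1 (suc n) = ℚ.≤-trans (ℚ.*-monoˡ-≤-nonNeg r (ℚ.≤-trans (^-suc≤ r<1 n) (ℚ.<⇒≤ r<1)))
                                 (ℚ.≤-reflexive (ℚ.*-identityʳ r))

  ^-suc≥ : 1ℚ ℚ.< r → ∀ n → r ℚ.≤ r ^ suc n
  ^-suc≥ 1<r zero    = ℚ.≤-reflexive (sym (ℚ.*-identityʳ r))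
  ^-suc≥ 1<r (suc n) = ℚ.≤-trans (ℚ.≤-reflexive (sym (ℚ.*-identityʳ r)))
                                 (ℚ.*-monoˡ-≤-nonNeg r (ℚ.≤-trans (ℚ.<⇒≤ 1<r) (^-suc≥ 1<r n)))

  ^-suc≢1 : r ≢ 1ℚ → ∀ n → r ^ suc n ≢ 1ℚ
  ^-suc≢1 r≢1 n rⁿ⁺¹≡1 with ℚ.<-cmp r 1ℚ
  ... | tri< r<1 _ _ = ℚ.<-irrefl refl (ℚ.≤-<-trans (subst (ℚ._≤ r) rⁿ⁺¹≡1 (^-suc≤ r<1 n)) r<1)
  ... | tri≈ _ r≡1 _ = r≢1 r≡1
  ... | tri> _ _ 1<r = ℚ.<-irrefl refl (ℚ.<-≤-trans 1<r (subst (r ℚ.≤_) rⁿ⁺¹≡1 (^-suc≥ 1<r n)))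

-- Over ℚ the only roots of unity are ±1: apply the monotonicity argument to q * q ≥ 0.
q≢±1⇒q^suc≢1 : ∀ {q} → q ≢ 1ℚ → q ≢ - 1ℚ → ∀ n → q ^ suc n ≢ 1ℚ
q≢±1⇒q^suc≢1 {q} q≢1 q≢-1 n qⁿ⁺¹≡1 =
  ^-suc≢1 (q * q) {{q*q-nonNeg}} q*q≢1 n
    (trans (^-distribʳ-* q q (suc n)) (cong₂ _*_ qⁿ⁺¹≡1 qⁿ⁺¹≡1))
  where
  q*q-nonNeg : NonNegative (q * q)
  q*q-nonNeg with ℚ.≤-total 0ℚ q
  ... | inj₁ 0≤q = ℚ.nonNeg*nonNeg⇒nonNeg q {{nonNegative 0≤q}} q {{nonNegative 0≤q}}
  -- despite its name, nonPos*nonPos⇒nonPos concludes NonNegative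
  ... | inj₂ q≤0 = ℚ.nonPos*nonPos⇒nonPos q {{nonPositive q≤0}} q {{nonPositive q≤0}}
  q*q≢1 : q * q ≢ 1ℚ
  q*q≢1 q²≡1 = *-≢0 (x≢y⇒x-y≢0 q≢1) (x≢y⇒x-y≢0 q≢-1) (begin
    (q - 1ℚ) * (q - - 1ℚ)
      ≡⟨ solve 1 (λ q → (q :- con 1ℚ) :* (q :- con (- 1ℚ)) := q :* q :- con 1ℚ) refl q ⟩
    q * q - 1ℚ
      ≡⟨ x≈y⇒x∙y⁻¹≈ε q²≡1 ⟩
    0ℚ ∎)

sumUpTo : ℕ → (ℕ → ℚ) → ℚ
sumUpTo n t = ∑[ i ≤ n ] t (toℕ i)

sumUpTo-suc : ∀ n t → sumUpTo (suc n) t ≡ sumUpTo n t + t (suc n)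
sumUpTo-suc n t = trans (sum-init-last {suc n} (t ∘ toℕ))
  (cong₂ _+_ (sum-cong-≗ {suc n} (cong t ∘ toℕ-inject₁)) (cong t (toℕ-fromℕ (suc n))))

≡ᵇ-refl : ∀ n → (n ≡ᵇ n) ≡ true
≡ᵇ-refl n = Equivalence.to T-≡ (ℕ.≡⇒≡ᵇ n n refl)

≢⇒≡ᵇ-false : ∀ {m n} → m ≢ n → (m ≡ᵇ n) ≡ false
≢⇒≡ᵇ-false {m} {n} m≢n = ¬-not (m≢n ∘ ℕ.≡ᵇ⇒≡ m n ∘ Equivalence.from T-≡)

BoundedBy : ℕ → Subset → Set
BoundedBy n P = ∀ k → n < k → P k ≡ false

boundedBy-suc : ∀ {n P} → BoundedBy n P → BoundedBy (suc n) P
boundedBy-suc {n} P⊆n k n+1<k = P⊆n k (ℕ.<-trans (ℕ.n<1+n n) n+1<k)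

insertSub-< : ∀ P {k n} → k < n → insertSub P n k ≡ P k
insertSub-< P k<n rewrite ≢⇒≡ᵇ-false (ℕ.<⇒≢ k<n) = refl

insertSub-boundedBy : ∀ {n P} → BoundedBy n P → BoundedBy (suc n) (insertSub P (suc n))
insertSub-boundedBy P⊆n k n+1<k rewrite ≢⇒≡ᵇ-false (ℕ.>⇒≢ n+1<k) = boundedBy-suc P⊆n k n+1<k

allSubsets-boundedBy : ∀ n → All (BoundedBy n) (allSubsets n)
allSubsets-boundedBy zero    = (λ _ _ → refl) ∷ []
allSubsets-boundedBy (suc n) = extend (allSubsets-boundedBy n)
  where
  extend : ∀ {Ps} → All (BoundedBy n) Ps →
           All (BoundedBy (suc n)) (concatMap (λ P → P ∷ insertSub P (suc n) ∷ []) Ps)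
  extend []            = []
  extend (P⊆n ∷ Ps⊆n) = boundedBy-suc P⊆n ∷ insertSub-boundedBy P⊆n ∷ extend Ps⊆n

elemsDesc-cong : ∀ m {P R} → (∀ k → k ≤ m → P k ≡ R k) → elemsDesc P m ≡ elemsDesc R m
elemsDesc-cong zero    _   = refl
elemsDesc-cong (suc m) P≗R rewrite P≗R (suc m) ℕ.≤-refl
  | elemsDesc-cong m (λ k k≤m → P≗R k (ℕ.m≤n⇒m≤1+n k≤m)) = refl

elemsDesc-insertSub-suc : ∀ n μ → elemsDesc (insertSub μ (suc n)) (suc n) ≡ suc n ∷ elemsDesc μ n
elemsDesc-insertSub-suc n μ rewrite ≡ᵇ-refl n =
  cong (suc n ∷_) (elemsDesc-cong n (λ k k≤n → insertSub-< μ (s≤s k≤n)))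

elemsDesc-insertSub : ∀ {n μ d} → BoundedBy n μ → suc n ≤′ d →
                      elemsDesc (insertSub μ (suc n)) d ≡ suc n ∷ elemsDesc μ n
elemsDesc-insertSub {n} {μ} _   ≤′-refl = elemsDesc-insertSub-suc n μ
elemsDesc-insertSub {n} {μ} μ⊆n (≤′-step {d} n<′d)
  rewrite ≢⇒≡ᵇ-false (ℕ.>⇒≢ (ℕ.≤′⇒≤ n<′d)) | μ⊆n (suc d) (ℕ.m≤n⇒m≤1+n (ℕ.≤′⇒≤ n<′d)) =
  elemsDesc-insertSub μ⊆n n<′d

module _ (q : ℚ) where

  qint-+ : ∀ m n → qint q (m ℕ.+ n) ≡ qint q m + q ^ m * qint q n
  qint-+ m zero    = trans (cong (qint q) (ℕ.+-identityʳ m))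
    (solve 2 (λ [m] qᵐ → [m] := [m] :+ qᵐ :* con 0ℚ) refl (qint q m) (q ^ m))
  qint-+ m (suc n) = begin
    qint q (m ℕ.+ suc n)                       ≡⟨ cong (qint q) (ℕ.+-suc m n) ⟩
    q ^ (m ℕ.+ n) + qint q (m ℕ.+ n)           ≡⟨ cong₂ _+_ (^-distribˡ-+-* q m n) (qint-+ m n) ⟩
    q ^ m * q ^ n + (qint q m + q ^ m * qint q n)
      ≡⟨ solve 4 (λ qᵐ qⁿ [m] [n] → qᵐ :* qⁿ :+ ([m] :+ qᵐ :* [n]) := [m] :+ qᵐ :* (qⁿ :+ [n]))
               refl (q ^ m) (q ^ n) (qint q m) (qint q n) ⟩
    qint q m + q ^ m * qint q (suc n)          ∎

  1-q*qint : ∀ n → (1ℚ - q) * qint q n ≡ 1ℚ - q ^ n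
  1-q*qint zero    = solve 1 (λ q → (con 1ℚ :- q) :* con 0ℚ := con 1ℚ :- con 1ℚ) refl q
  1-q*qint (suc n) = begin
    (1ℚ - q) * (q ^ n + qint q n)              ≡⟨ ℚ.*-distribˡ-+ (1ℚ - q) (q ^ n) (qint q n) ⟩
    (1ℚ - q) * q ^ n + (1ℚ - q) * qint q n     ≡⟨ cong ((1ℚ - q) * q ^ n +_) (1-q*qint n) ⟩
    (1ℚ - q) * q ^ n + (1ℚ - q ^ n)
      ≡⟨ solve 2 (λ q qⁿ → (con 1ℚ :- q) :* qⁿ :+ (con 1ℚ :- qⁿ) := con 1ℚ :- q :* qⁿ) refl q (q ^ n) ⟩
    1ℚ - q ^ suc n                             ∎

  gauss : ℕ → ℕ → ℚ
  gauss a       zero    = 1ℚ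
  gauss zero    (suc b) = 0ℚ
  gauss (suc a) (suc b) = q ^ suc b * gauss a (suc b) + gauss a b

  gauss-< : ∀ {a b} → a < b → gauss a b ≡ 0ℚ
  gauss-< {zero}  {suc b} _         = refl
  gauss-< {suc a} {suc b} (s≤s a<b) = begin
    q ^ suc b * gauss a (suc b) + gauss a b
      ≡⟨ cong₂ (λ x y → q ^ suc b * x + y) (gauss-< (ℕ.m≤n⇒m≤1+n a<b)) (gauss-< a<b) ⟩
    q ^ suc b * 0ℚ + 0ℚ
      ≡⟨ solve 1 (λ Q → Q :* con 0ℚ :+ con 0ℚ := con 0ℚ) refl (q ^ suc b) ⟩
    0ℚ ∎

  gauss-diag : ∀ a → gauss a a ≡ 1ℚ
  gauss-diag zero    = refl
  gauss-diag (suc a) = begin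
    q ^ suc a * gauss a (suc a) + gauss a a
      ≡⟨ cong₂ (λ x y → q ^ suc a * x + y) (gauss-< (ℕ.n<1+n a)) (gauss-diag a) ⟩
    q ^ suc a * 0ℚ + 1ℚ
      ≡⟨ solve 1 (λ Q → Q :* con 0ℚ :+ con 1ℚ := con 1ℚ) refl (q ^ suc a) ⟩
    1ℚ ∎

  mutual
    gauss-*-qfact : ∀ b c → gauss (b ℕ.+ c) b * (qfact q b * qfact q c) ≡ qfact q (b ℕ.+ c)
    gauss-*-qfact zero    c = solve 1 (λ f → con 1ℚ :* (con 1ℚ :* f) := f) refl (qfact q c)
    gauss-*-qfact (suc b) c = begin
      (Q * g₁ + g₀) * (qint q (suc b) * qfact q b * qfact q c)
        ≡⟨ solve 6 (λ Q g₁ g₀ I f f′ → (Q :* g₁ :+ g₀) :* (I :* f :* f′)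
                                       := Q :* (g₁ :* (I :* f :* f′)) :+ I :* (g₀ :* (f :* f′)))
                 refl Q g₁ g₀ (qint q (suc b)) (qfact q b) (qfact q c) ⟩
      Q * (g₁ * (qfact q (suc b) * qfact q c)) + qint q (suc b) * (g₀ * (qfact q b * qfact q c))
        ≡⟨ cong₂ (λ x y → Q * x + qint q (suc b) * y) (gauss-suc-*-qfact b c) (gauss-*-qfact b c) ⟩
      Q * (qint q c * qfact q (b ℕ.+ c)) + qint q (suc b) * qfact q (b ℕ.+ c)
        ≡⟨ solve 4 (λ Q J f I → Q :* (J :* f) :+ I :* f := (I :+ Q :* J) :* f)
                 refl Q (qint q c) (qfact q (b ℕ.+ c)) (qint q (suc b)) ⟩
      (qint q (suc b) + Q * qint q c) * qfact q (b ℕ.+ c)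
        ≡⟨ cong (_* qfact q (b ℕ.+ c)) (qint-+ (suc b) c) ⟨
      qfact q (suc b ℕ.+ c) ∎
      where Q  = q ^ suc b
            g₁ = gauss (b ℕ.+ c) (suc b)
            g₀ = gauss (b ℕ.+ c) b

    gauss-suc-*-qfact : ∀ b c →
      gauss (b ℕ.+ c) (suc b) * (qfact q (suc b) * qfact q c) ≡ qint q c * qfact q (b ℕ.+ c)
    gauss-suc-*-qfact b zero = begin
      gauss (b ℕ.+ 0) (suc b) * (qfact q (suc b) * 1ℚ)
        ≡⟨ cong (_* (qfact q (suc b) * 1ℚ)) (gauss-< (s≤s (ℕ.≤-reflexive (ℕ.+-identityʳ b)))) ⟩
      0ℚ * (qfact q (suc b) * 1ℚ)
        ≡⟨ solve 2 (λ x y → con 0ℚ :* x := con 0ℚ :* y) refl (qfact q (suc b) * 1ℚ) (qfact q (b ℕ.+ 0)) ⟩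
      0ℚ * qfact q (b ℕ.+ 0) ∎
    gauss-suc-*-qfact b (suc c) = begin
      gauss (b ℕ.+ suc c) (suc b) * (qfact q (suc b) * (qint q (suc c) * qfact q c))
        ≡⟨ cong (λ a → gauss a (suc b) * (qfact q (suc b) * (qint q (suc c) * qfact q c))) (ℕ.+-suc b c) ⟩
      gauss (suc b ℕ.+ c) (suc b) * (qfact q (suc b) * (qint q (suc c) * qfact q c))
        ≡⟨ solve 4 (λ g f I f′ → g :* (f :* (I :* f′)) := I :* (g :* (f :* f′)))
                 refl (gauss (suc b ℕ.+ c) (suc b)) (qfact q (suc b)) (qint q (suc c)) (qfact q c) ⟩
      qint q (suc c) * (gauss (suc b ℕ.+ c) (suc b) * (qfact q (suc b) * qfact q c))
        ≡⟨ cong (qint q (suc c) *_) (gauss-*-qfact (suc b) c) ⟩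
      qint q (suc c) * qfact q (suc b ℕ.+ c)
        ≡⟨ cong (λ a → qint q (suc c) * qfact q a) (ℕ.+-suc b c) ⟨
      qint q (suc c) * qfact q (b ℕ.+ suc c) ∎

  qpoch : ℕ → ℚ
  qpoch n = prodℚ (map (λ j → 1ℚ - q ^ j) (range1 n))

  -- qpochFrom x c = (q^(x+1); q)_c
  qpochFrom : ℕ → ℕ → ℚ
  qpochFrom x zero    = 1ℚ
  qpochFrom x (suc c) = (1ℚ - q ^ suc x) * qpochFrom (suc x) c

  qpoch-+ : ∀ b c → qpoch (b ℕ.+ c) ≡ qpoch b * qpochFrom b c
  qpoch-+ b zero    = trans (cong qpoch (ℕ.+-identityʳ b)) (sym (ℚ.*-identityʳ (qpoch b)))
  qpoch-+ b (suc c) = begin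
    qpoch (b ℕ.+ suc c)                               ≡⟨ cong qpoch (ℕ.+-suc b c) ⟩
    qpoch (suc b ℕ.+ c)                               ≡⟨ qpoch-+ (suc b) c ⟩
    (1ℚ - q ^ suc b) * qpoch b * qpochFrom (suc b) c
      ≡⟨ solve 3 (λ u e f → u :* e :* f := e :* (u :* f))
               refl (1ℚ - q ^ suc b) (qpoch b) (qpochFrom (suc b) c) ⟩
    qpoch b * qpochFrom b (suc c)                     ∎

  qpochSquares : ℕ → ℚ
  qpochSquares n = prodℚ (map (λ j → 1ℚ - q ^ (j ℕ.* j)) (range1 n))

  durfeeTerm : ℕ → ℕ → ℕ → ℚ
  durfeeTerm k a b = gauss a b * q ^ (b ℕ.* (k ℕ.+ b)) * qpochFrom (k ℕ.+ b) (a ∸ b)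

  durfeeTerm-diag : ∀ a → durfeeTerm 0 a a ≡ q ^ (a ℕ.* a)
  durfeeTerm-diag a = begin
    gauss a a * q ^ (a ℕ.* a) * qpochFrom a (a ∸ a)
      ≡⟨ cong₂ (λ g c → g * q ^ (a ℕ.* a) * qpochFrom a c) (gauss-diag a) (ℕ.n∸n≡0 a) ⟩
    1ℚ * q ^ (a ℕ.* a) * 1ℚ
      ≡⟨ solve 1 (λ x → con 1ℚ :* x :* con 1ℚ := x) refl (q ^ (a ℕ.* a)) ⟩
    q ^ (a ℕ.* a) ∎

  -- By the q-Pascal rule each term splits as G + H; the G-terms lose their top term, and
  -- G b + H b is the term for k + 1 because (1 - q^(k+b+1)) + q^(k+b+1) = 1.
  durfeeSum-suc : ∀ k a → sumUpTo (suc a) (durfeeTerm k (suc a)) ≡ sumUpTo a (durfeeTerm (suc k) a)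
  durfeeSum-suc k a = begin
    sumUpTo (suc a) (durfeeTerm k (suc a))     ≡⟨ cong (G 0 +_) (sum-cong-≗ {suc a} (pascal ∘ toℕ)) ⟩
    G 0 + sumUpTo a (λ b → G (suc b) + H b)    ≡⟨ cong (G 0 +_) (∑-distrib-+ {suc a} (G ∘ suc ∘ toℕ) (H ∘ toℕ)) ⟩
    G 0 + (sumUpTo a (G ∘ suc) + sumUpTo a H)  ≡⟨ ℚ.+-assoc (G 0) _ _ ⟨
    sumUpTo (suc a) G + sumUpTo a H            ≡⟨ cong (_+ sumUpTo a H) (sumUpTo-suc a G) ⟩
    sumUpTo a G + G (suc a) + sumUpTo a H      ≡⟨ cong (λ x → sumUpTo a G + x + sumUpTo a H) G-top ⟩
    sumUpTo a G + 0ℚ + sumUpTo a H             ≡⟨ cong (_+ sumUpTo a H) (ℚ.+-identityʳ (sumUpTo a G)) ⟩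
    sumUpTo a G + sumUpTo a H                  ≡⟨ ∑-distrib-+ {suc a} (G ∘ toℕ) (H ∘ toℕ) ⟨
    sumUpTo a (λ b → G b + H b)                ≡⟨ sum-cong-≗ {suc a} (λ i → merge (toℕ i) (toℕ≤pred[n] i)) ⟩
    sumUpTo a (durfeeTerm (suc k) a)           ∎
    where
    G H : ℕ → ℚ
    G b = q ^ b * gauss a b * q ^ (b ℕ.* (k ℕ.+ b)) * qpochFrom (k ℕ.+ b) (suc a ∸ b)
    H b = gauss a b * q ^ (suc b ℕ.* (k ℕ.+ suc b)) * qpochFrom (k ℕ.+ suc b) (a ∸ b)

    pascal : ∀ b → durfeeTerm k (suc a) (suc b) ≡ G (suc b) + H b
    pascal b = solve 5 (λ Q g₁ g₀ E F → (Q :* g₁ :+ g₀) :* E :* F := Q :* g₁ :* E :* F :+ g₀ :* E :* F)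
      refl (q ^ suc b) (gauss a (suc b)) (gauss a b)
      (q ^ (suc b ℕ.* (k ℕ.+ suc b))) (qpochFrom (k ℕ.+ suc b) (a ∸ b))

    G-top : G (suc a) ≡ 0ℚ
    G-top = begin
      q ^ suc a * gauss a (suc a) * E * F  ≡⟨ cong (λ g → q ^ suc a * g * E * F) (gauss-< (ℕ.n<1+n a)) ⟩
      q ^ suc a * 0ℚ * E * F               ≡⟨ solve 3 (λ Q E F → Q :* con 0ℚ :* E :* F := con 0ℚ) refl (q ^ suc a) E F ⟩
      0ℚ                                   ∎
      where E = q ^ (suc a ℕ.* (k ℕ.+ suc a))
            F = qpochFrom (k ℕ.+ suc a) (a ∸ a)

    merge : ∀ b → b ≤ a → G b + H b ≡ durfeeTerm (suc k) a b
    merge b b≤a = begin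
      qᵇ * g * E * qpochFrom x (suc a ∸ b) + g * q ^ (suc b ℕ.* (k ℕ.+ suc b)) * qpochFrom (k ℕ.+ suc b) (a ∸ b)
        ≡⟨ cong₂ (λ u v → qᵇ * g * E * qpochFrom x u + g * q ^ (suc b ℕ.* v) * qpochFrom v (a ∸ b))
                 (ℕ.+-∸-assoc 1 b≤a) (ℕ.+-suc k b) ⟩
      qᵇ * g * E * ((1ℚ - q ^ suc x) * F) + g * q ^ (suc x ℕ.+ b ℕ.* suc x) * F
        ≡⟨ cong (λ e → qᵇ * g * E * ((1ℚ - q ^ suc x) * F) + g * e * F) exponent-suc ⟩
      qᵇ * g * E * ((1ℚ - q ^ suc x) * F) + g * (q ^ suc x * (qᵇ * E)) * F
        ≡⟨ solve 5 (λ qᵇ g E Q F → qᵇ :* g :* E :* ((con 1ℚ :- Q) :* F) :+ g :* (Q :* (qᵇ :* E)) :* F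
                                  := g :* (qᵇ :* E) :* F) refl qᵇ g E (q ^ suc x) F ⟩
      g * (qᵇ * E) * F
        ≡⟨ cong (λ e → g * e * F) exponent ⟨
      durfeeTerm (suc k) a b ∎
      where
      x  = k ℕ.+ b
      qᵇ = q ^ b
      g  = gauss a b
      E  = q ^ (b ℕ.* x)
      F  = qpochFrom (suc x) (a ∸ b)
      exponent : q ^ (b ℕ.* suc x) ≡ qᵇ * E
      exponent = trans (cong (q ^_) (ℕ.*-suc b x)) (^-distribˡ-+-* q b (b ℕ.* x))
      exponent-suc : q ^ (suc x ℕ.+ b ℕ.* suc x) ≡ q ^ suc x * (qᵇ * E)
      exponent-suc = trans (^-distribˡ-+-* q (suc x) (b ℕ.* suc x)) (cong (q ^ suc x *_) exponent)

  durfeeSum≡1 : ∀ k a → sumUpTo a (durfeeTerm k a) ≡ 1ℚ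
  durfeeSum≡1 k zero    = refl
  durfeeSum≡1 k (suc a) = trans (durfeeSum-suc k a) (durfeeSum≡1 (suc k) a)

  durfeeSum-below-diag : ∀ n → sumUpTo n (durfeeTerm 0 (suc n)) ≡ 1ℚ - q ^ (suc n ℕ.* suc n)
  durfeeSum-below-diag n = begin
    S                                            ≡⟨ solve 2 (λ S c → S := S :+ c :- c) refl S c ⟩
    S + c - c                                    ≡⟨ cong (λ x → S + x - c) (durfeeTerm-diag (suc n)) ⟨
    S + durfeeTerm 0 (suc n) (suc n) - c         ≡⟨ cong (_- c) (sumUpTo-suc n (durfeeTerm 0 (suc n))) ⟨
    sumUpTo (suc n) (durfeeTerm 0 (suc n)) - c   ≡⟨ cong (_- c) (durfeeSum≡1 0 (suc n)) ⟩
    1ℚ - c                                       ∎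
    where S = sumUpTo n (durfeeTerm 0 (suc n))
          c = q ^ (suc n ℕ.* suc n)

  weight-cong : ∀ m {P R} → (∀ k → k ≤ m → P k ≡ R k) → weight q m P ≡ weight q m R
  weight-cong zero    _   = refl
  weight-cong (suc m) P≗R rewrite P≗R (suc m) ℕ.≤-refl
    | weight-cong m (λ k k≤m → P≗R k (ℕ.m≤n⇒m≤1+n k≤m)) = refl

  -- ∑ over μ ⊆ {1,…,n} of g (elements of μ in decreasing order) * weight q n μ, by cases on n ∈ μ.
  weightedSum : (List ℕ → ℚ) → ℕ → ℚ
  weightedSum g zero    = g []
  weightedSum g (suc n) = (1ℚ - q ^ (suc n ℕ.* suc n)) * weightedSum g n
                        + q ^ (suc n ℕ.* suc n) * weightedSum (g ∘ (suc n ∷_)) n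

  weightedSum-cong : ∀ {g h} n → (∀ l → g l ≡ h l) → weightedSum g n ≡ weightedSum h n
  weightedSum-cong zero    g≗h = g≗h []
  weightedSum-cong (suc n) g≗h = cong₂ (λ x y → (1ℚ - c) * x + c * y)
    (weightedSum-cong n g≗h) (weightedSum-cong n (g≗h ∘ (suc n ∷_)))
    where c = q ^ (suc n ℕ.* suc n)

  weightedSum-scale : ∀ x g n → weightedSum (λ l → x * g l) n ≡ x * weightedSum g n
  weightedSum-scale x g zero    = refl
  weightedSum-scale x g (suc n) = begin
    (1ℚ - c) * weightedSum (λ l → x * g l) n + c * weightedSum (λ l → x * g (suc n ∷ l)) n
      ≡⟨ cong₂ (λ u v → (1ℚ - c) * u + c * v) (weightedSum-scale x g n) (weightedSum-scale x (g ∘ (suc n ∷_)) n) ⟩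
    (1ℚ - c) * (x * weightedSum g n) + c * (x * weightedSum (g ∘ (suc n ∷_)) n)
      ≡⟨ solve 4 (λ c x u v → (con 1ℚ :- c) :* (x :* u) :+ c :* (x :* v)
                             := x :* ((con 1ℚ :- c) :* u :+ c :* v))
               refl c x (weightedSum g n) (weightedSum (g ∘ (suc n ∷_)) n) ⟩
    x * weightedSum g (suc n) ∎
    where c = q ^ (suc n ℕ.* suc n)

  weightedTerm : ℕ → (List ℕ → ℚ) → Subset → ℚ
  weightedTerm n g μ = g (elemsDesc μ n) * weight q n μ

  weightedTerm-suc : ∀ {n P} g → BoundedBy n P →
                     weightedTerm (suc n) g P ≡ (1ℚ - q ^ (suc n ℕ.* suc n)) * weightedTerm n g P
  weightedTerm-suc {n} {P} g P⊆n rewrite P⊆n (suc n) (ℕ.n<1+n n) =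
    solve 3 (λ u x w → x :* (u :* w) := u :* (x :* w)) refl
      (1ℚ - q ^ (suc n ℕ.* suc n)) (g (elemsDesc P n)) (weight q n P)

  weightedTerm-insertSub : ∀ n P g → weightedTerm (suc n) g (insertSub P (suc n))
                                     ≡ q ^ (suc n ℕ.* suc n) * weightedTerm n (g ∘ (suc n ∷_)) P
  weightedTerm-insertSub n P g rewrite elemsDesc-insertSub-suc n P | ≡ᵇ-refl n
    | weight-cong n (λ k k≤n → insertSub-< P (s≤s k≤n)) =
    solve 3 (λ c x w → x :* (c :* w) := c :* (x :* w)) refl
      (q ^ (suc n ℕ.* suc n)) (g (suc n ∷ elemsDesc P n)) (weight q n P)

  sum-allSubsets : ∀ n g → sumℚ (map (weightedTerm n g) (allSubsets n)) ≡ weightedSum g n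
  sum-allSubsets zero    g = solve 1 (λ x → x :* con 1ℚ :+ con 0ℚ := x) refl (g [])
  sum-allSubsets (suc n) g = trans (split (allSubsets-boundedBy n))
    (cong₂ (λ x y → (1ℚ - c) * x + c * y) (sum-allSubsets n g) (sum-allSubsets n (g ∘ (suc n ∷_))))
    where
    c = q ^ (suc n ℕ.* suc n)
    split : ∀ {Ps} → All (BoundedBy n) Ps →
            sumℚ (map (weightedTerm (suc n) g) (concatMap (λ P → P ∷ insertSub P (suc n) ∷ []) Ps))
            ≡ (1ℚ - c) * sumℚ (map (weightedTerm n g) Ps)
              + c * sumℚ (map (weightedTerm n (g ∘ (suc n ∷_))) Ps)
    split [] = solve 1 (λ c → con 0ℚ := (con 1ℚ :- c) :* con 0ℚ :+ c :* con 0ℚ) refl c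
    split {P ∷ Ps} (P⊆n ∷ Ps⊆n)
      rewrite weightedTerm-suc g P⊆n | weightedTerm-insertSub n P g | split Ps⊆n =
      solve 5 (λ c x y u v → (con 1ℚ :- c) :* x :+ (c :* y :+ ((con 1ℚ :- c) :* u :+ c :* v))
                             := (con 1ℚ :- c) :* (x :+ u) :+ c :* (y :+ v))
        refl c (weightedTerm n g P) (weightedTerm n (g ∘ (suc n ∷_)) P)
        (sumℚ (map (weightedTerm n g) Ps)) (sumℚ (map (weightedTerm n (g ∘ (suc n ∷_))) Ps))

  multinom : ℕ → List ℕ → ℚ
  multinom a l = qmultinom q a (parts a l)

  qbinomSet≡multinom : ∀ {d P x l} → elemsDesc P d ≡ x ∷ l → qbinomSet q d P ≡ multinom d (x ∷ l)
  qbinomSet≡multinom eq rewrite eq = refl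

  module _ (q^suc≢1 : ∀ n → q ^ suc n ≢ 1ℚ) where

    1-q^suc≢0 : ∀ n → 1ℚ - q ^ suc n ≢ 0ℚ
    1-q^suc≢0 n = x≢y⇒x-y≢0 (q^suc≢1 n ∘ sym)

    qfact≢0 : ∀ n → qfact q n ≢ 0ℚ
    qfact≢0 zero    = λ ()
    qfact≢0 (suc n) = *-≢0 qint≢0 (qfact≢0 n)
      where
      qint≢0 : qint q (suc n) ≢ 0ℚ
      qint≢0 [n+1]≡0 = 1-q^suc≢0 n (begin
        1ℚ - q ^ suc n             ≡⟨ 1-q*qint (suc n) ⟨
        (1ℚ - q) * qint q (suc n)  ≡⟨ cong ((1ℚ - q) *_) [n+1]≡0 ⟩
        (1ℚ - q) * 0ℚ              ≡⟨ ℚ.*-zeroʳ (1ℚ - q) ⟩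
        0ℚ                         ∎)

    prodℚ-qfact≢0 : ∀ ms → prodℚ (map (qfact q) ms) ≢ 0ℚ
    prodℚ-qfact≢0 []       = λ ()
    prodℚ-qfact≢0 (m ∷ ms) = *-≢0 (qfact≢0 m) (prodℚ-qfact≢0 ms)

    qpoch≢0 : ∀ n → qpoch n ≢ 0ℚ
    qpoch≢0 zero    = λ ()
    qpoch≢0 (suc n) = *-≢0 (1-q^suc≢0 n) (qpoch≢0 n)

    qbinom≡gauss : ∀ {a b} → b ≤ a → qbinom q a b ≡ gauss a b
    qbinom≡gauss {a} {b} b≤a = ÷'-unique (*-≢0 (qfact≢0 b) (qfact≢0 (a ∸ b))) (begin
      qfact q b * qfact q (a ∸ b) * gauss a b  ≡⟨ ℚ.*-comm _ (gauss a b) ⟩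
      gauss a b * (qfact q b * qfact q (a ∸ b))
        ≡⟨ subst (λ a′ → gauss a′ b * (qfact q b * qfact q (a ∸ b)) ≡ qfact q a′)
                 (ℕ.m+[n∸m]≡n b≤a) (gauss-*-qfact b (a ∸ b)) ⟩
      qfact q a                                ∎)

    multinom-[] : ∀ a → multinom a [] ≡ 1ℚ
    multinom-[] a = ÷'-unique (*-≢0 (qfact≢0 a) (λ ()))
      (trans (ℚ.*-identityʳ _) (ℚ.*-identityʳ (qfact q a)))

    multinom-∷ : ∀ a m l → multinom a (m ∷ l) ≡ qbinom q a m * multinom m l
    multinom-∷ a m l = ÷'-unique (*-≢0 (qfact≢0 (a ∸ m)) Π≢0) (begin
      qfact q (a ∸ m) * Π * (qbinom q a m * (qfact q m ÷' Π))
        ≡⟨ solve 4 (λ f Π b r → f :* Π :* (b :* r) := b :* f :* (Π :* r))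
                 refl (qfact q (a ∸ m)) Π (qbinom q a m) (qfact q m ÷' Π) ⟩
      qbinom q a m * qfact q (a ∸ m) * (Π * (qfact q m ÷' Π))
        ≡⟨ cong (qbinom q a m * qfact q (a ∸ m) *_) (*-÷'-cancel (qfact q m) Π≢0) ⟩
      qbinom q a m * qfact q (a ∸ m) * qfact q m
        ≡⟨ solve 3 (λ b f g → b :* f :* g := g :* f :* b) refl (qbinom q a m) (qfact q (a ∸ m)) (qfact q m) ⟩
      qfact q m * qfact q (a ∸ m) * qbinom q a m
        ≡⟨ *-÷'-cancel (qfact q a) (*-≢0 (qfact≢0 m) (qfact≢0 (a ∸ m))) ⟩
      qfact q a ∎)
      where Π = prodℚ (map (qfact q) (parts m l))
            Π≢0 = prodℚ-qfact≢0 (parts m l)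

    weightedSum-multinom-∷ : ∀ a m n →
      weightedSum (multinom a ∘ (m ∷_)) n ≡ qbinom q a m * weightedSum (multinom m) n
    weightedSum-multinom-∷ a m n =
      trans (weightedSum-cong n (multinom-∷ a m)) (weightedSum-scale (qbinom q a m) (multinom m) n)

    qpoch*weightedSum-multinom : ∀ {n a} → n ≤ a →
      qpoch a * weightedSum (multinom a) n ≡ qpochSquares n * sumUpTo n (durfeeTerm 0 a)
    qpoch*weightedSum-multinom {zero} {a} _ = begin
      qpoch a * multinom a []
        ≡⟨ cong₂ _*_ (qpoch-+ 0 a) (multinom-[] a) ⟩
      1ℚ * qpochFrom 0 a * 1ℚ
        ≡⟨ solve 1 (λ F → con 1ℚ :* F :* con 1ℚ := con 1ℚ :* (con 1ℚ :* con 1ℚ :* F :+ con 0ℚ)) refl (qpochFrom 0 a) ⟩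
      qpochSquares 0 * sumUpTo 0 (durfeeTerm 0 a) ∎
    qpoch*weightedSum-multinom {suc n} {a} n<a = begin
      qpoch a * ((1ℚ - c) * W + c * W′)
        ≡⟨ solve 4 (λ e c w w′ → e :* ((con 1ℚ :- c) :* w :+ c :* w′) := (con 1ℚ :- c) :* (e :* w) :+ c :* (e :* w′))
                 refl (qpoch a) c W W′ ⟩
      (1ℚ - c) * (qpoch a * W) + c * (qpoch a * W′)
        ≡⟨ cong₂ (λ x y → (1ℚ - c) * x + c * y) (qpoch*weightedSum-multinom (ℕ.<⇒≤ n<a)) top ⟩
      (1ℚ - c) * (P * S) + c * (g * F * (P * (1ℚ - c)))
        ≡⟨ solve 5 (λ c P S g F → (con 1ℚ :- c) :* (P :* S) :+ c :* (g :* F :* (P :* (con 1ℚ :- c)))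
                                  := (con 1ℚ :- c) :* P :* (S :+ g :* c :* F))
                 refl c P S g F ⟩
      qpochSquares (suc n) * (S + durfeeTerm 0 a (suc n))
        ≡⟨ cong (qpochSquares (suc n) *_) (sumUpTo-suc n (durfeeTerm 0 a)) ⟨
      qpochSquares (suc n) * sumUpTo (suc n) (durfeeTerm 0 a) ∎
      where
      c  = q ^ (suc n ℕ.* suc n)
      W  = weightedSum (multinom a) n
      W′ = weightedSum (multinom a ∘ (suc n ∷_)) n
      V  = weightedSum (multinom (suc n)) n
      P  = qpochSquares n
      S  = sumUpTo n (durfeeTerm 0 a)
      g  = gauss a (suc n)
      F  = qpochFrom (suc n) (a ∸ suc n)
      qpoch-a : qpoch a ≡ qpoch (suc n) * F
      qpoch-a = trans (cong qpoch (sym (ℕ.m+[n∸m]≡n n<a))) (qpoch-+ (suc n) (a ∸ suc n))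
      top : qpoch a * W′ ≡ g * F * (P * (1ℚ - c))
      top = begin
        qpoch a * W′                           ≡⟨ cong (qpoch a *_) (weightedSum-multinom-∷ a (suc n) n) ⟩
        qpoch a * (qbinom q a (suc n) * V)     ≡⟨ cong₂ (λ e b → e * (b * V)) qpoch-a (qbinom≡gauss n<a) ⟩
        qpoch (suc n) * F * (g * V)            ≡⟨ solve 4 (λ e F g v → e :* F :* (g :* v) := g :* F :* (e :* v))
                                                        refl (qpoch (suc n)) F g V ⟩
        g * F * (qpoch (suc n) * V)
          ≡⟨ cong (g * F *_) (qpoch*weightedSum-multinom (ℕ.n≤1+n n)) ⟩
        g * F * (P * sumUpTo n (durfeeTerm 0 (suc n)))
          ≡⟨ cong (λ s → g * F * (P * s)) (durfeeSum-below-diag n) ⟩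
        g * F * (P * (1ℚ - c)) ∎

    weightedSum-multinom : ∀ n → weightedSum (multinom (suc n)) n ≡ qpochSquares (suc n) ÷' qpoch (suc n)
    weightedSum-multinom n = sym (÷'-unique (qpoch≢0 (suc n)) (begin
      qpoch (suc n) * weightedSum (multinom (suc n)) n   ≡⟨ qpoch*weightedSum-multinom (ℕ.n≤1+n n) ⟩
      qpochSquares n * sumUpTo n (durfeeTerm 0 (suc n))  ≡⟨ cong (qpochSquares n *_) (durfeeSum-below-diag n) ⟩
      qpochSquares n * (1ℚ - q ^ (suc n ℕ.* suc n))      ≡⟨ ℚ.*-comm (qpochSquares n) _ ⟩
      qpochSquares (suc n)                                ∎))

    lhs≡qbinom*weightedSum : ∀ {d n} → suc n ≤ d →
      lhs q d (suc n) ≡ qbinom q d (suc n) * weightedSum (multinom (suc n)) n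
    lhs≡qbinom*weightedSum {d} {n} n<d = begin
      lhs q d (suc n)
        ≡⟨ cong sumℚ (map-cong-local (All.map insert-first (allSubsets-boundedBy n))) ⟩
      sumℚ (map (weightedTerm n (multinom d ∘ (suc n ∷_))) (allSubsets n))
        ≡⟨ sum-allSubsets n (multinom d ∘ (suc n ∷_)) ⟩
      weightedSum (multinom d ∘ (suc n ∷_)) n
        ≡⟨ weightedSum-multinom-∷ d (suc n) n ⟩
      qbinom q d (suc n) * weightedSum (multinom (suc n)) n ∎
      where
      insert-first : ∀ {μ} → BoundedBy n μ →
        qbinomSet q d (insertSub μ (suc n)) * weight q n μ ≡ weightedTerm n (multinom d ∘ (suc n ∷_)) μ
      insert-first {μ} μ⊆n =
        cong (_* weight q n μ) (qbinomSet≡multinom {d} (elemsDesc-insertSub μ⊆n (ℕ.≤⇒≤′ n<d)))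

    qpoch*∏÷' : ∀ n →
      qpoch n * prodℚ (map (λ j → (1ℚ - q ^ (j ℕ.* j)) ÷' (1ℚ - q ^ j)) (range1 n)) ≡ qpochSquares n
    qpoch*∏÷' zero    = refl
    qpoch*∏÷' (suc n) = begin
      y * qpoch n * ((x ÷' y) * R)  ≡⟨ solve 4 (λ y e r R → y :* e :* (r :* R) := y :* r :* (e :* R))
                                             refl y (qpoch n) (x ÷' y) R ⟩
      y * (x ÷' y) * (qpoch n * R)  ≡⟨ cong₂ _*_ (*-÷'-cancel x (1-q^suc≢0 n)) (qpoch*∏÷' n) ⟩
      x * qpochSquares n            ∎
      where x = 1ℚ - q ^ (suc n ℕ.* suc n)
            y = 1ℚ - q ^ suc n
            R = prodℚ (map (λ j → (1ℚ - q ^ (j ℕ.* j)) ÷' (1ℚ - q ^ j)) (range1 n))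

lemma3p3 : (d i : ℕ) → 1 ≤ i → i ≤ d → (q : ℚ) → q ≢ 1ℚ → q ≢ - 1ℚ →
    lhs q d i ≡ rhs q d i
lemma3p3 d zero    () _
lemma3p3 d (suc n) _  i≤d q q≢1 q≢-1 = begin
  lhs q d (suc n)
    ≡⟨ lhs≡qbinom*weightedSum q q^suc≢1 i≤d ⟩
  qbinom q d (suc n) * weightedSum q (multinom q (suc n)) n
    ≡⟨ cong (qbinom q d (suc n) *_) (weightedSum-multinom q q^suc≢1 n) ⟩
  qbinom q d (suc n) * (qpochSquares q (suc n) ÷' qpoch q (suc n))
    ≡⟨ cong (qbinom q d (suc n) *_) (÷'-unique (qpoch≢0 q q^suc≢1 (suc n)) (qpoch*∏÷' q q^suc≢1 (suc n))) ⟩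
  rhs q d (suc n) ∎
  where q^suc≢1 = q≢±1⇒q^suc≢1 q≢1 q≢-1
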